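{- Let $G$ be a graph with vertex set $\{v_1,\ldots,v_n\}$ and let $H$ be the bipartite graph with vertex set $\{u_1,\ldots,u_n\}\cup\{w_1,\ldots,w_n\}$ and edge set $\{u_iw_j,u_jw_i: v_iv_j\in E(G)\}\cup\{u_iw_i:1\leq i\leq n\}$. If $G$ has an interval total $t$-coloring, then $H$ has an interval $t$-coloring.
   Context: All graphs are finite, undirected, without loops or multiple edges. A total coloring of a graph $G$ is an assignment of colors to the vertices and edges of $G$ such that no two adjacent vertices, no two adjacent edges, and no vertex and an edge incident to it receive the same color. For a positive integer $t$, an interval total $t$-coloring of $G$ is a total coloring of $G$ with colors $1,2,\ldots,t$ such that each color $i\in\{1,\ldots,t\}$ is used on at least one vertex or edge, and for each vertex $v$ the set consisting of the color of $v$ and the colors of the edges incident to $v$ consists of $d_G(v)+1$ consecutive integers, where $d_G(v)$ is the degree of $v$. An interval $t$-coloring of a graph is a proper edge-coloring with colors $1,\ldots,t$ in which each color $i\in\{1,\ldots,t\}$ is used on at least one edge and the edges incident to each vertex $v$ receive $d(v)$ consecutive colors. -}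

module Defs where

open import Data.Nat using (ℕ; _≤_; _<_)
open import Data.Fin using (Fin; _≟_)
open import Data.Bool using (Bool; true; false; _∨_)
open import Data.Sum using (_⊎_; inj₁; inj₂)
open import Data.Product using (_×_; Σ; ∃; ∃-syntax)
open import Relation.Nullary using (¬_; does)
open import Relation.Binary.PropositionalEquality using (_≡_; _≢_)

record Graph (V : Set) : Set where
  field
    adj    : V → V → Bool
    sym    : ∀ u v → adj u v ≡ adj v u
    irrefl : ∀ v → adj v v ≡ false

open Graph public

Edge : {V : Set} → Graph V → V → V → Set
Edge G u v = adj G u v ≡ true

Consecutive : (ℕ → Set) → Set
Consecutive S = ∃[ a ] ∃[ b ] (∀ k → (S k → a ≤ k × k < b) × (a ≤ k → k < b → S k))

-- Edge colorings are functions c : V → V → ℕ, only meaningful on edges;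
-- the color of edge uv is c u v = c v u.

record IsIntervalColoring {V : Set} (G : Graph V) (t : ℕ) (c : V → V → ℕ) : Set where
  field
    symm     : ∀ u v → Edge G u v → c u v ≡ c v u
    range    : ∀ u v → Edge G u v → 1 ≤ c u v × c u v ≤ t
    proper   : ∀ u v w → Edge G u v → Edge G u w → v ≢ w → c u v ≢ c u w
    surj     : ∀ k → 1 ≤ k → k ≤ t → ∃[ u ] ∃[ v ] (Edge G u v × c u v ≡ k)
    interval : ∀ v → Consecutive (λ k → ∃[ u ] (Edge G v u × c v u ≡ k))

HasIntervalColoring : {V : Set} → Graph V → ℕ → Set
HasIntervalColoring G t = ∃[ c ] IsIntervalColoring G t c

record IsIntervalTotalColoring {V : Set} (G : Graph V) (t : ℕ)
         (cv : V → ℕ) (ce : V → V → ℕ) : Set where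
  field
    symm       : ∀ u v → Edge G u v → ce u v ≡ ce v u
    rangeV     : ∀ v → 1 ≤ cv v × cv v ≤ t
    rangeE     : ∀ u v → Edge G u v → 1 ≤ ce u v × ce u v ≤ t
    properV    : ∀ u v → Edge G u v → cv u ≢ cv v
    properE    : ∀ u v w → Edge G u v → Edge G u w → v ≢ w → ce u v ≢ ce u w
    properVE   : ∀ u v → Edge G u v → cv u ≢ ce u v
    surj       : ∀ k → 1 ≤ k → k ≤ t →
                   (∃[ v ] (cv v ≡ k)) ⊎ (∃[ u ] ∃[ v ] (Edge G u v × ce u v ≡ k))
    interval   : ∀ v → Consecutive (λ k → (cv v ≡ k) ⊎ (∃[ u ] (Edge G v u × ce v u ≡ k)))

HasIntervalTotalColoring : {V : Set} → Graph V → ℕ → Set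
HasIntervalTotalColoring G t = ∃[ cv ] ∃[ ce ] IsIntervalTotalColoring G t cv ce

-- The bipartite graph H built from G on {v_1..v_n}:
-- vertices u_i = inj₁ i, w_i = inj₂ i; u_i w_j is an edge iff i = j or v_i v_j ∈ E(G).
H-adj : {n : ℕ} → Graph (Fin n) → Fin n ⊎ Fin n → Fin n ⊎ Fin n → Bool
H-adj G (inj₁ i) (inj₂ j) = does (i ≟ j) ∨ adj G i j
H-adj G (inj₂ j) (inj₁ i) = does (i ≟ j) ∨ adj G i j
H-adj G (inj₁ _) (inj₁ _) = false
H-adj G (inj₂ _) (inj₂ _) = false

H-sym : {n : ℕ} (G : Graph (Fin n)) → ∀ x y → H-adj G x y ≡ H-adj G y x
H-sym G (inj₁ i) (inj₁ j) = Relation.Binary.PropositionalEquality.refl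
H-sym G (inj₁ i) (inj₂ j) = Relation.Binary.PropositionalEquality.refl
H-sym G (inj₂ j) (inj₁ i) = Relation.Binary.PropositionalEquality.refl
H-sym G (inj₂ i) (inj₂ j) = Relation.Binary.PropositionalEquality.refl

H-irrefl : {n : ℕ} (G : Graph (Fin n)) → ∀ x → H-adj G x x ≡ false
H-irrefl G (inj₁ i) = Relation.Binary.PropositionalEquality.refl
H-irrefl G (inj₂ i) = Relation.Binary.PropositionalEquality.refl

H : {n : ℕ} → Graph (Fin n) → Graph (Fin n ⊎ Fin n)
H G = record { adj = H-adj G ; sym = H-sym G ; irrefl = H-irrefl G }

-- A total coloring of G is an edge coloring of G with a loop added at every
-- vertex, the loop at v_i carrying the color of v_i; an interval total coloring
-- becomes an interval coloring of this looped graph.  H is its bipartite double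
-- cover: u_i w_j is an edge of H iff v_i v_j is an edge or loop.  Coloring u_i w_j
-- with the color of v_i v_j gives u_i and w_i exactly the colors seen at v_i, so
-- both properness and the interval property are inherited from G.
module Submission where

open import Defs hiding (sym)
open import Data.Nat using (ℕ; _≤_)
open import Data.Fin using (Fin; _≟_)
open import Data.Sum using (_⊎_; inj₁; inj₂)
open import Data.Product using (_×_; _,_; ∃-syntax; proj₁; proj₂)
open import Data.Empty using (⊥-elim)
open import Relation.Nullary using (yes; no)
open import Relation.Binary.PropositionalEquality
  using (_≡_; _≢_; refl; sym; trans; cong)

Consecutive-resp : {P Q : ℕ → Set} → (∀ {k} → P k → Q k) → (∀ {k} → Q k → P k) →
                   Consecutive P → Consecutive Q
Consecutive-resp P⇒Q Q⇒P (a , b , bounds) =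
  a , b , λ k → (λ q → proj₁ (bounds k) (Q⇒P q)) , (λ a≤k k<b → P⇒Q (proj₂ (bounds k) a≤k k<b))

module _ {V : Set} (G : Graph V) where

  Edge-irrefl : ∀ {u v} → Edge G u v → u ≢ v
  Edge-irrefl {u} e refl with trans (sym e) (irrefl G u)
  ... | ()

  Edge-sym : ∀ {u v} → Edge G u v → Edge G v u
  Edge-sym {u} {v} e = trans (Graph.sym G v u) e

  LoopAdj : V → V → Set
  LoopAdj u v = u ≡ v ⊎ Edge G u v

  LoopAdj-sym : ∀ {u v} → LoopAdj u v → LoopAdj v u
  LoopAdj-sym (inj₁ u≡v) = inj₁ (sym u≡v)
  LoopAdj-sym (inj₂ e)   = inj₂ (Edge-sym e)

  record IsLoopedIntervalColoring (t : ℕ) (c : V → V → ℕ) : Set where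
    field
      symm     : ∀ {u v} → LoopAdj u v → c u v ≡ c v u
      range    : ∀ {u v} → LoopAdj u v → 1 ≤ c u v × c u v ≤ t
      proper   : ∀ {u v w} → LoopAdj u v → LoopAdj u w → v ≢ w → c u v ≢ c u w
      surj     : ∀ k → 1 ≤ k → k ≤ t → ∃[ u ] ∃[ v ] (LoopAdj u v × c u v ≡ k)
      interval : ∀ u → Consecutive (λ k → ∃[ v ] (LoopAdj u v × c u v ≡ k))

merge : {n : ℕ} → (Fin n → ℕ) → (Fin n → Fin n → ℕ) → Fin n → Fin n → ℕ
merge cv ce i j with i ≟ j
... | yes _ = cv i
... | no _  = ce i j

merge-diag : {n : ℕ} (cv : Fin n → ℕ) (ce : Fin n → Fin n → ℕ) {i j : Fin n} →
             i ≡ j → merge cv ce i j ≡ cv i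
merge-diag cv ce {i} {j} i≡j with i ≟ j
... | yes _   = refl
... | no i≢j  = ⊥-elim (i≢j i≡j)

merge-off : {n : ℕ} (cv : Fin n → ℕ) (ce : Fin n → Fin n → ℕ) {i j : Fin n} →
            i ≢ j → merge cv ce i j ≡ ce i j
merge-off cv ce {i} {j} i≢j with i ≟ j
... | yes i≡j = ⊥-elim (i≢j i≡j)
... | no _    = refl

module _ {n t : ℕ} {G : Graph (Fin n)} {cv : Fin n → ℕ} {ce : Fin n → Fin n → ℕ}
         (T : IsIntervalTotalColoring G t cv ce) where
  open IsIntervalTotalColoring T

  private
    c : Fin n → Fin n → ℕ
    c = merge cv ce

    c-diag : ∀ i → c i i ≡ cv i
    c-diag i = merge-diag cv ce refl

    c-edge : ∀ {i j} → Edge G i j → c i j ≡ ce i j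
    c-edge e = merge-off cv ce (Edge-irrefl G e)

  merge-symm : ∀ {i j} → LoopAdj G i j → c i j ≡ c j i
  merge-symm (inj₁ refl) = refl
  merge-symm (inj₂ e)    = trans (c-edge e) (trans (symm _ _ e) (sym (c-edge (Edge-sym G e))))

  merge-range : ∀ {i j} → LoopAdj G i j → 1 ≤ c i j × c i j ≤ t
  merge-range {i} (inj₁ refl) rewrite c-diag i = rangeV i
  merge-range     (inj₂ e)    rewrite c-edge e = rangeE _ _ e

  merge-proper : ∀ {i j k} → LoopAdj G i j → LoopAdj G i k → j ≢ k → c i j ≢ c i k
  merge-proper (inj₁ refl) (inj₁ refl) j≢k _ = j≢k refl
  merge-proper {i} (inj₁ refl) (inj₂ e) _ eq =
    properVE i _ e (trans (sym (c-diag i)) (trans eq (c-edge e)))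
  merge-proper {i} (inj₂ e) (inj₁ refl) _ eq =
    properVE i _ e (trans (sym (c-diag i)) (trans (sym eq) (c-edge e)))
  merge-proper (inj₂ e) (inj₂ e′) j≢k eq =
    properE _ _ _ e e′ j≢k (trans (sym (c-edge e)) (trans eq (c-edge e′)))

  merge-surj : ∀ k → 1 ≤ k → k ≤ t → ∃[ i ] ∃[ j ] (LoopAdj G i j × c i j ≡ k)
  merge-surj k 1≤k k≤t with surj k 1≤k k≤t
  ... | inj₁ (i , cvi≡k)         = i , i , inj₁ refl , trans (c-diag i) cvi≡k
  ... | inj₂ (i , j , e , ceij≡k) = i , j , inj₂ e , trans (c-edge e) ceij≡k

  merge-interval : ∀ i → Consecutive (λ k → ∃[ j ] (LoopAdj G i j × c i j ≡ k))
  merge-interval i = Consecutive-resp from to (interval i)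
    where
    from : ∀ {k} → (cv i ≡ k) ⊎ (∃[ j ] (Edge G i j × ce i j ≡ k)) →
           ∃[ j ] (LoopAdj G i j × c i j ≡ k)
    from (inj₁ cvi≡k)           = i , inj₁ refl , trans (c-diag i) cvi≡k
    from (inj₂ (j , e , ceij≡k)) = j , inj₂ e , trans (c-edge e) ceij≡k

    to : ∀ {k} → ∃[ j ] (LoopAdj G i j × c i j ≡ k) →
         (cv i ≡ k) ⊎ (∃[ j ] (Edge G i j × ce i j ≡ k))
    to (j , inj₁ refl , cij≡k) = inj₁ (trans (sym (c-diag i)) cij≡k)
    to (j , inj₂ e , cij≡k)    = inj₂ (j , e , trans (sym (c-edge e)) cij≡k)

  merge-isLoopedIntervalColoring : IsLoopedIntervalColoring G t (merge cv ce)
  merge-isLoopedIntervalColoring = record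
    { symm = merge-symm ; range = merge-range ; proper = merge-proper
    ; surj = merge-surj ; interval = merge-interval }

module _ {n : ℕ} (G : Graph (Fin n)) where

  Edge-H⇒LoopAdj : ∀ i j → Edge (H G) (inj₁ i) (inj₂ j) → LoopAdj G i j
  Edge-H⇒LoopAdj i j e with i ≟ j
  ... | yes i≡j = inj₁ i≡j
  ... | no _    = inj₂ e

  LoopAdj⇒Edge-H : ∀ {i j} → LoopAdj G i j → Edge (H G) (inj₁ i) (inj₂ j)
  LoopAdj⇒Edge-H {i} {j} a with i ≟ j | a
  ... | yes _   | _         = refl
  ... | no i≢j  | inj₁ i≡j  = ⊥-elim (i≢j i≡j)
  ... | no _    | inj₂ e    = e

  -- Junk value 0 off the bipartite pairs, which are the only possible edges of H.
  liftH : (Fin n → Fin n → ℕ) → Fin n ⊎ Fin n → Fin n ⊎ Fin n → ℕ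
  liftH c (inj₁ i) (inj₂ j) = c i j
  liftH c (inj₂ j) (inj₁ i) = c i j
  liftH c _        _        = 0

  module _ {t : ℕ} {c : Fin n → Fin n → ℕ} (L : IsLoopedIntervalColoring G t c) where
    open IsLoopedIntervalColoring L

    private
      Spectrum : Fin n → ℕ → Set
      Spectrum i k = ∃[ j ] (LoopAdj G i j × c i j ≡ k)

      SpectrumH : Fin n ⊎ Fin n → ℕ → Set
      SpectrumH x k = ∃[ y ] (Edge (H G) x y × liftH c x y ≡ k)

    liftH-symm : ∀ x y → Edge (H G) x y → liftH c x y ≡ liftH c y x
    liftH-symm (inj₁ i) (inj₂ j) _ = refl
    liftH-symm (inj₂ j) (inj₁ i) _ = refl

    liftH-range : ∀ x y → Edge (H G) x y → 1 ≤ liftH c x y × liftH c x y ≤ t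
    liftH-range (inj₁ i) (inj₂ j) e = range (Edge-H⇒LoopAdj i j e)
    liftH-range (inj₂ j) (inj₁ i) e = range (Edge-H⇒LoopAdj i j e)

    -- At w_j the colors c i j are read as c j i, turning column properness into row properness.
    liftH-proper : ∀ x y z → Edge (H G) x y → Edge (H G) x z → y ≢ z →
                   liftH c x y ≢ liftH c x z
    liftH-proper (inj₁ i) (inj₂ j) (inj₂ k) e e′ y≢z =
      proper (Edge-H⇒LoopAdj i j e) (Edge-H⇒LoopAdj i k e′) (λ j≡k → y≢z (cong inj₂ j≡k))
    liftH-proper (inj₂ j) (inj₁ i) (inj₁ k) e e′ y≢z eq =
      proper (LoopAdj-sym G a) (LoopAdj-sym G a′) (λ i≡k → y≢z (cong inj₁ i≡k))
             (trans (sym (symm a)) (trans eq (symm a′)))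
      where
      a  = Edge-H⇒LoopAdj i j e
      a′ = Edge-H⇒LoopAdj k j e′
    liftH-proper (inj₁ _) (inj₂ _) (inj₁ _) _ ()
    liftH-proper (inj₂ _) (inj₁ _) (inj₂ _) _ ()

    liftH-surj : ∀ k → 1 ≤ k → k ≤ t → ∃[ x ] ∃[ y ] (Edge (H G) x y × liftH c x y ≡ k)
    liftH-surj k 1≤k k≤t with surj k 1≤k k≤t
    ... | i , j , a , cij≡k = inj₁ i , inj₂ j , LoopAdj⇒Edge-H a , cij≡k

    SpectrumH-u⇒Spectrum : ∀ i {k} → SpectrumH (inj₁ i) k → Spectrum i k
    SpectrumH-u⇒Spectrum i (inj₂ j , e , eq) = j , Edge-H⇒LoopAdj i j e , eq

    Spectrum⇒SpectrumH-u : ∀ i {k} → Spectrum i k → SpectrumH (inj₁ i) k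
    Spectrum⇒SpectrumH-u i (j , a , eq) = inj₂ j , LoopAdj⇒Edge-H a , eq

    SpectrumH-w⇒Spectrum : ∀ j {k} → SpectrumH (inj₂ j) k → Spectrum j k
    SpectrumH-w⇒Spectrum j (inj₁ i , e , eq) =
      i , LoopAdj-sym G a , trans (sym (symm a)) eq
      where a = Edge-H⇒LoopAdj i j e

    Spectrum⇒SpectrumH-w : ∀ j {k} → Spectrum j k → SpectrumH (inj₂ j) k
    Spectrum⇒SpectrumH-w j (i , a , eq) =
      inj₁ i , LoopAdj⇒Edge-H (LoopAdj-sym G a) , trans (symm (LoopAdj-sym G a)) eq

    liftH-interval : ∀ x → Consecutive (SpectrumH x)
    liftH-interval (inj₁ i) =
      Consecutive-resp (Spectrum⇒SpectrumH-u i) (SpectrumH-u⇒Spectrum i) (interval i)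
    liftH-interval (inj₂ j) =
      Consecutive-resp (Spectrum⇒SpectrumH-w j) (SpectrumH-w⇒Spectrum j) (interval j)

    liftH-isIntervalColoring : IsIntervalColoring (H G) t (liftH c)
    liftH-isIntervalColoring = record
      { symm = liftH-symm ; range = liftH-range ; proper = liftH-proper
      ; surj = liftH-surj ; interval = liftH-interval }

theorem3 : (n t : ℕ) (G : Graph (Fin n)) →
    HasIntervalTotalColoring G t → HasIntervalColoring (H G) t
theorem3 n t G (cv , ce , T) =
  liftH G (merge cv ce) , liftH-isIntervalColoring G (merge-isLoopedIntervalColoring T)
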